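{- Let $A_5$ be the alternating group on $\{1,2,3,4,5\}$, acted on by $S_5$ via conjugation. Then: (1) every $4$-valent type I regular balanced Cayley map on $A_5$ is isomorphic to $\mathcal{CM}_{(123)}^{(1425)}$; (2) every $6$-valent type I regular balanced Cayley map on $A_5$ is isomorphic to $\mathcal{CM}_{(123)}^{(12)(345)}$; (3) for $n>3$ there does not exist a $2n$-valent type I regular balanced Cayley map on $A_5$.
   Context: Let $\Gamma$ be a finite group and $\Omega\subseteq\Gamma$ a generating set with $1\notin\Omega$ and $\Omega^{ -1}=\Omega$. The Cayley graph $\mathrm{Cay}(\Gamma,\Omega)$ has vertex set $\Gamma$ and arcs $(\eta,\omega)\in\Gamma\times\Omega$ from $\eta$ to $\eta\omega$. A cyclic permutation $\rho$ of $\Omega$ gives a cyclic order on the arcs leaving each vertex via $(\eta,\omega)\mapsto(\eta,\rho(\omega))$, which determines a cellular embedding of $\mathrm{Cay}(\Gamma,\Omega)$ into a closed oriented surface; this is the Cayley map $\mathcal{CM}(\Gamma,\Omega,\rho)$. An isomorphism of Cayley maps is an isomorphism of the underlying graphs compatible with the cyclic orders. The map is regular if its automorphism group acts transitively on arcs, and balanced if $\rho(\omega^{ -1})=\rho(\omega)^{ -1}$ for all $\omega\in\Omega$; write RBCM for regular balanced Cayley map. Its valency is $\#\Omega$. In an RBCM all elements of $\Omega$ have the same order; it is of type I if they are not involutions (then $\#\Omega=2n$ and, writing $\Omega=\{\omega_1,\dots,\omega_{2n}\}$ with $\rho(\omega_i)=\omega_{i+1}$, one has $\omega_{i+n}=\omega_i^{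 -1}$), and of type II if all elements of $\Omega$ are involutions. Notation: for $\sigma\in S_5$ and $\omega\in A_5$, $\mathcal{CM}_{\omega}^{\sigma}$ denotes the Cayley map $\mathcal{CM}(A_5,\Omega,\rho)$ with $\Omega=\{\sigma^i\omega\sigma^{ -i}:1\le i\le m\}$ ($m$ the number of distinct such conjugates) and $\rho(\sigma^i\omega\sigma^{ -i})=\sigma^{i+1}\omega\sigma^{ -(i+1)}$. Permutations are composed left to right: $\omega\psi$ means first apply $\omega$, then $\psi$ (e.g. $(12)(23)=(132)$). -}

module Defs where

open import Data.Nat using (ℕ; zero; suc; _+_; _*_; _<_; _%_)
open import Data.Nat.DivMod using (m%n<n)
open import Data.Bool using (Bool; true; false; T; _∧_; if_then_else_; not)
open import Data.Fin using (Fin; zero; suc; toℕ; fromℕ<)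
open import Data.Fin.Properties using () renaming (_≟_ to _≟F_)
open import Data.Vec using (Vec; _∷_; []; lookup; tabulate; map; allFin)
open import Data.Vec.Properties using (≡-dec)
open import Data.List using (List; []; _∷_; foldr; length; deduplicate; upTo) renaming (map to lmap)
open import Data.Product using (Σ; ∃; _×_; _,_)
open import Relation.Nullary using (¬_; does)
open import Relation.Binary.PropositionalEquality using (_≡_; _≢_)

-- Permutations of {1,…,5}, encoded 0-indexed as the vector of images:
-- σ : Perm5 represents the map x ↦ lookup σ x on Fin 5.
Perm5 : Set
Perm5 = Vec (Fin 5) 5

_≟P_ : (σ τ : Perm5) → Relation.Nullary.Dec (σ ≡ τ)
_≟P_ = ≡-dec _≟F_

_==P_ : Perm5 → Perm5 → Bool
σ ==P τ = does (σ ≟P τ)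

_==F_ : Fin 5 → Fin 5 → Bool
x ==F y = does (x ≟F y)

idP : Perm5
idP = tabulate (λ x → x)

-- Left-to-right composition: σ · τ = "first σ, then τ".
infixl 7 _·_
_·_ : Perm5 → Perm5 → Perm5
σ · τ = map (lookup τ) σ

anyL : {A : Set} → (A → Bool) → List A → Bool
anyL p = foldr (λ a b → p a Data.Bool.∨ b) false

allL : {A : Set} → (A → Bool) → List A → Bool
allL p = foldr (λ a b → p a ∧ b) true

fins : List (Fin 5)
fins = Data.Vec.toList (allFin 5)

preimage : Perm5 → Fin 5 → Fin 5
preimage σ y = go fins
  where
  go : List (Fin 5) → Fin 5
  go [] = zero
  go (x ∷ xs) = if lookup σ x ==F y then x else go xs

inv : Perm5 → Perm5
inv σ = tabulate (preimage σ)

isPerm : Perm5 → Bool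
isPerm σ = allL (λ y → anyL (λ x → lookup σ x ==F y) fins) fins

_<ᵇF_ : Fin 5 → Fin 5 → Bool
x <ᵇF y = Data.Nat._<ᵇ_ (toℕ x) (toℕ y)

inversionsEven : Perm5 → Bool
inversionsEven σ =
  foldr (λ i b → foldr (λ j c → if (i <ᵇF j) ∧ (lookup σ j <ᵇF lookup σ i) then not c else c) b fins)
        true fins

isA5 : Perm5 → Bool
isA5 σ = isPerm σ ∧ inversionsEven σ

InA5 : Perm5 → Set
InA5 σ = T (isA5 σ)

InS5 : Perm5 → Set
InS5 σ = T (isPerm σ)

prod : List Perm5 → Perm5
prod [] = idP
prod (x ∷ xs) = x · prod xs

next : ∀ {k} → Fin k → Fin k
next {suc k} i = fromℕ< (m%n<n (suc (toℕ i)) (suc k))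

-- A Cayley map CM(A₅, Ω, ρ) is given by a listing Ω = (ω_0,…,ω_{k-1})
-- of the generating set, with ρ the cyclic permutation ω_i ↦ ω_{i+1 mod k}.
record IsCayleyMap {k : ℕ} (Ω : Vec Perm5 k) : Set where
  field
    inA5      : ∀ i → InA5 (lookup Ω i)
    distinct  : ∀ i j → lookup Ω i ≡ lookup Ω j → i ≡ j
    noId      : ∀ i → lookup Ω i ≢ idP
    invClosed : ∀ i → ∃ λ j → lookup Ω j ≡ inv (lookup Ω i)
    -- Ω generates A₅ (Ω = Ω⁻¹, so words in Ω suffice)
    generates : ∀ g → InA5 g → ∃ λ (w : List (Fin k)) → prod (lmap (lookup Ω) w) ≡ g

-- Isomorphism of Cayley maps CM(A₅,Ω,ρ) → CM(A₅,Ω',ρ').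
-- f is the vertex bijection of A₅, φ η i is the index of the image of the arc (η, ω_i):
-- the arc (η, ω_i) is sent to the arc (f η, ω'_{φ η i}).
record Iso {k k' : ℕ} (Ω : Vec Perm5 k) (Ω' : Vec Perm5 k') : Set where
  field
    f     : Perm5 → Perm5
    g     : Perm5 → Perm5
    φ     : Perm5 → Fin k → Fin k'
    f-A5  : ∀ η → InA5 η → InA5 (f η)
    g-A5  : ∀ η → InA5 η → InA5 (g η)
    gf    : ∀ η → InA5 η → g (f η) ≡ η
    fg    : ∀ η → InA5 η → f (g η) ≡ η
    arc   : ∀ η → InA5 η → ∀ i → f (η · lookup Ω i) ≡ f η · lookup Ω' (φ η i)
    refl-adj : ∀ η η' → InA5 η → InA5 η' → ∀ j →
               f η' ≡ f η · lookup Ω' j → ∃ λ i → η' ≡ η · lookup Ω i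
    rot   : ∀ η → InA5 η → ∀ i → φ η (next i) ≡ next (φ η i)

open Iso public

Regular : ∀ {k} → Vec Perm5 k → Set
Regular {k} Ω = ∀ η η' → InA5 η → InA5 η' → ∀ (i i' : Fin k) →
  Σ (Iso Ω Ω) λ F → (f F η ≡ η') × (φ F η i ≡ i')

Balanced : ∀ {k} → Vec Perm5 k → Set
Balanced Ω = ∀ i j → lookup Ω j ≡ inv (lookup Ω i) →
  lookup Ω (next j) ≡ inv (lookup Ω (next i))

record RBCM {k : ℕ} (Ω : Vec Perm5 k) : Set where
  field
    cayley   : IsCayleyMap Ω
    regular  : Regular Ω
    balanced : Balanced Ω

TypeI : ∀ {k} → Vec Perm5 k → Set
TypeI Ω = ∀ i → ¬ (lookup Ω i · lookup Ω i ≡ idP)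

-- The Cayley map CM^σ_ω : Ω = {σ^i ω σ^{-i} : 1 ≤ i ≤ m}, ρ(σ^i ω σ^{-i}) = σ^{i+1} ω σ^{-(i+1)}.
pow : Perm5 → ℕ → Perm5
pow σ zero = idP
pow σ (suc n) = σ · pow σ n

conjPow : Perm5 → Perm5 → ℕ → Perm5
conjPow σ ω i = pow σ i · ω · inv (pow σ i)

-- m = number of distinct conjugates σ^i ω σ^{-i} (i ranges over 1..120 ⊇ a full period)
numConj : Perm5 → Perm5 → ℕ
numConj σ ω = length (deduplicate _≟P_ (lmap (λ i → conjPow σ ω (suc i)) (upTo 120)))

CMgens : (σ ω : Perm5) → Vec Perm5 (numConj σ ω)
CMgens σ ω = tabulate (λ i → conjPow σ ω (suc (toℕ i)))

c123 : Perm5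
c123 = Data.Fin.# 1 ∷ Data.Fin.# 2 ∷ Data.Fin.# 0 ∷ Data.Fin.# 3 ∷ Data.Fin.# 4 ∷ []

c1425 : Perm5
c1425 = Data.Fin.# 3 ∷ Data.Fin.# 4 ∷ Data.Fin.# 2 ∷ Data.Fin.# 1 ∷ Data.Fin.# 0 ∷ []

c12-345 : Perm5
c12-345 = Data.Fin.# 1 ∷ Data.Fin.# 0 ∷ Data.Fin.# 3 ∷ Data.Fin.# 4 ∷ Data.Fin.# 2 ∷ []

module Submission where

-- Let Ω = (ω₀, …, ω_{k-1}) list the generators of a regular balanced Cayley map on A₅.  By
-- regularity some automorphism F fixes the vertex 1 and sends the arc (1, ω₀) to (1, ω₁); since F
-- respects the cyclic orders it shifts the arcs at 1 by one step, and balancedness propagates this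
-- along every arc, so that F(η ωᵢ) = F(η) ωᵢ₊₁ everywhere.  Hence F is a group automorphism of A₅
-- with F(ωᵢ) = ωᵢ₊₁.  Every automorphism of A₅ is conjugation by some σ ∈ S₅, so Ω is the orbit
-- ω₀, ω₀^σ, ω₀^σ², … ; as elements of S₅ have order at most 6, k ≤ 6.  For k = 4 and 6 a search
-- over all pairs (σ, ω₀) whose orbit satisfies the necessary conditions finds a conjugation in A₅,
-- combined with a rotation of the indices, onto the generating list of the stated map.  The finite
-- facts about A₅ and S₅ (closure, element orders, Aut A₅, the final search) are verified by
-- exhaustive computation.

open import Defs
open import Data.Nat using (ℕ; _*_; _<_)
open import Data.Vec using (Vec)
open import Data.Product using (_×_)
open import Data.Empty using (⊥)

open import Data.Nat using (zero; suc; _+_; _%_; s≤s; NonZero)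
open import Data.Nat.Properties
  using (1+n≢0; *-identityˡ; +-identityʳ; +-suc; +-assoc; +-comm; *-suc; *-monoʳ-≤; ≤-trans; <-≤-trans; n≤1+n)
open import Data.Nat.DivMod using (m<n⇒m%n≡m; [m+kn]%n≡m%n; %-distribˡ-+; m%n%n≡m%n)
open import Data.Nat.GeneralisedArithmetic using (fold; fold-+)
open import Data.Bool.Properties using (T?; T-∧)
open import Data.Fin using (Fin; zero; suc; toℕ; #_)
open import Data.Fin.Properties using (toℕ-injective; toℕ-fromℕ<; toℕ<n) renaming (any? to anyFin?; all? to allFin?)
open import Data.Vec using ([]; _∷_; lookup)
open import Data.Vec.Properties using (lookup-map; map-∘; map-cong; map-id; lookup∘tabulate; tabulate-∘; tabulate∘lookup)
open import Data.List
  using (List; []; _∷_; [_]; _++_; filter; deduplicate; cartesianProduct; cartesianProductWith; allFin; upTo)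
  renaming (map to mapL)
open import Data.List.Relation.Unary.All as All using (All; all?)
open import Data.List.Relation.Unary.Any using (Any; any?; here)
open import Data.List.Membership.Propositional using (_∈_; find)
open import Data.List.Membership.Propositional.Properties
  using (∈-allFin; ∈-cartesianProductWith⁺; ∈-cartesianProduct⁺; ∈-cartesianProduct⁻; ∈-filter⁺; ∈-filter⁻;
         ∈-++⁻; ∈-map⁻; ∈-deduplicate⁻; ∈-upTo⁻)
open import Data.List.Membership.DecPropositional _≟P_ using (_∈?_)
open import Data.Product using (Σ-syntax; ∃; _,_; proj₁; proj₂)
import Data.Product.Properties as Product
open import Data.Sum using (_⊎_; inj₁; inj₂)
open import Function using (_∘_; Equivalence)
open import Relation.Nullary using (¬_; Dec; ¬?)
open import Relation.Nullary.Decidable using (from-yes; _×-dec_; _→-dec_)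
open import Relation.Unary using (Decidable)
open import Relation.Binary.PropositionalEquality
  using (_≡_; _≢_; _≗_; refl; sym; trans; cong; cong₂; subst; module ≡-Reasoning)
open ≡-Reasoning

infixl 8 _^_

_^_ : Perm5 → Perm5 → Perm5
x ^ σ = inv σ · x · σ

·-assoc : ∀ σ τ υ → σ · τ · υ ≡ σ · (τ · υ)
·-assoc σ τ υ = trans (sym (map-∘ (lookup υ) (lookup τ) σ)) (map-cong (λ x → sym (lookup-map x (lookup υ) τ)) σ)

·-identityˡ : ∀ σ → idP · σ ≡ σ
·-identityˡ σ = trans (sym (tabulate-∘ (lookup σ) (λ x → x))) (tabulate∘lookup σ)

·-identityʳ : ∀ σ → σ · idP ≡ σ
·-identityʳ σ = trans (map-cong (lookup∘tabulate (λ x → x)) σ) (map-id σ)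

pow-suc : ∀ σ n → pow σ (suc n) ≡ pow σ n · σ
pow-suc σ zero    = trans (·-identityʳ σ) (sym (·-identityˡ σ))
pow-suc σ (suc n) = trans (cong (σ ·_) (pow-suc σ n)) (sym (·-assoc σ (pow σ n) σ))

vectors : ∀ m n → List (Vec (Fin m) n)
vectors m zero    = [ [] ]
vectors m (suc n) = cartesianProductWith _∷_ (allFin m) (vectors m n)

∈-vectors : ∀ {m n} (v : Vec (Fin m) n) → v ∈ vectors m n
∈-vectors []      = here refl
∈-vectors (x ∷ v) = ∈-cartesianProductWith⁺ _∷_ (∈-allFin x) (∈-vectors v)

-- ys is an argument rather than a subterm of the predicate, so that the normaliser evaluates it
-- once instead of once per element of xs.
all-any? : {A B : Set} {R : A → B → Set} → (∀ x y → Dec (R x y)) →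
           (xs : List A) (ys : List B) → Dec (All (λ x → Any (R x) ys) xs)
all-any? R? xs ys = all? (λ x → any? (R? x) ys) xs

-- Opaque, so that type checking never unfolds these lists when comparing types; only the
-- `unfolding` blocks below compute with them.
opaque
  S5 : List Perm5
  S5 = filter (T? ∘ isPerm) (vectors 5 5)

  A5 : List Perm5
  A5 = filter (T? ∘ isA5) S5

opaque
  unfolding A5

  ∈A5⁺ : ∀ x → InA5 x → x ∈ A5
  ∈A5⁺ x x∈ = ∈-filter⁺ (T? ∘ isA5) {xs = S5}
    (∈-filter⁺ (T? ∘ isPerm) {xs = vectors 5 5} (∈-vectors x) (proj₁ (Equivalence.to T-∧ x∈))) x∈

  ∈A5⁻ : ∀ {x} → x ∈ A5 → InA5 x
  ∈A5⁻ x∈ = proj₂ (∈-filter⁻ (T? ∘ isA5) {xs = S5} x∈)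

  InA5⇒∈S5 : ∀ x → InA5 x → x ∈ S5
  InA5⇒∈S5 x x∈ = proj₁ (∈-filter⁻ (T? ∘ isA5) {xs = S5} (∈A5⁺ x x∈))

  S5-inverseʳ : All (λ σ → σ · inv σ ≡ idP) S5
  S5-inverseʳ = from-yes (all? (λ σ → (σ · inv σ) ≟P idP) S5)

  S5-inverseˡ : All (λ σ → inv σ · σ ≡ idP) S5
  S5-inverseˡ = from-yes (all? (λ σ → (inv σ · σ) ≟P idP) S5)

  S5-order≤6 : All (λ σ → Any (λ m → pow σ (suc m) ≡ idP) (upTo 6)) S5
  S5-order≤6 = from-yes (all? (λ σ → any? (λ m → pow σ (suc m) ≟P idP) (upTo 6)) S5)

  A5-·-closed : All (λ p → InA5 (proj₁ p · proj₂ p)) (cartesianProduct A5 A5)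
  A5-·-closed = from-yes (all? (λ p → T? (isA5 (proj₁ p · proj₂ p))) (cartesianProduct A5 A5))

  A5-inv-closed : All (λ x → InA5 (inv x)) A5
  A5-inv-closed = from-yes (all? (λ x → T? (isA5 (inv x))) A5)

·-inverseʳ : ∀ {σ} → σ ∈ S5 → σ · inv σ ≡ idP
·-inverseʳ = All.lookup S5-inverseʳ

·-inverseˡ : ∀ {σ} → σ ∈ S5 → inv σ · σ ≡ idP
·-inverseˡ = All.lookup S5-inverseˡ

InA5-· : ∀ x y → InA5 x → InA5 y → InA5 (x · y)
InA5-· x y x∈ y∈ = All.lookup A5-·-closed (∈-cartesianProduct⁺ {xs = A5} {ys = A5} (∈A5⁺ x x∈) (∈A5⁺ y y∈))

InA5-inv : ∀ x → InA5 x → InA5 (inv x)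
InA5-inv x x∈ = All.lookup A5-inv-closed (∈A5⁺ x x∈)

InA5-pow : ∀ x n → InA5 x → InA5 (pow x n)
InA5-pow x zero    _  = _
InA5-pow x (suc n) x∈ = InA5-· x (pow x n) x∈ (InA5-pow x n x∈)

module _ {σ : Perm5} (σ∈ : σ ∈ S5) where

  ·-cancelˡ : ∀ {x y} → σ · x ≡ σ · y → x ≡ y
  ·-cancelˡ {x} {y} eq = begin
    x                 ≡⟨ sym (·-identityˡ x) ⟩
    idP · x           ≡⟨ cong (_· x) (sym (·-inverseˡ σ∈)) ⟩
    inv σ · σ · x     ≡⟨ ·-assoc (inv σ) σ x ⟩
    inv σ · (σ · x)   ≡⟨ cong (inv σ ·_) eq ⟩
    inv σ · (σ · y)   ≡⟨ sym (·-assoc (inv σ) σ y) ⟩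
    inv σ · σ · y     ≡⟨ cong (_· y) (·-inverseˡ σ∈) ⟩
    idP · y           ≡⟨ ·-identityˡ y ⟩
    y                 ∎

  inverse-unique : ∀ {x} → σ · x ≡ idP → x ≡ inv σ
  inverse-unique eq = ·-cancelˡ (trans eq (sym (·-inverseʳ σ∈)))

  ^-intertwine : ∀ x → σ · x ^ σ ≡ x · σ
  ^-intertwine x = begin
    σ · (inv σ · x · σ)   ≡⟨ sym (·-assoc σ (inv σ · x) σ) ⟩
    σ · (inv σ · x) · σ   ≡⟨ cong (_· σ) (sym (·-assoc σ (inv σ) x)) ⟩
    σ · inv σ · x · σ     ≡⟨ cong (λ z → z · x · σ) (·-inverseʳ σ∈) ⟩
    idP · x · σ           ≡⟨ cong (_· σ) (·-identityˡ x) ⟩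
    x · σ                 ∎

  ^-distrib-· : ∀ x y → (x · y) ^ σ ≡ x ^ σ · y ^ σ
  ^-distrib-· x y = sym (·-cancelˡ (begin
    σ · (x ^ σ · y ^ σ)   ≡⟨ sym (·-assoc σ (x ^ σ) (y ^ σ)) ⟩
    σ · x ^ σ · y ^ σ     ≡⟨ cong (_· y ^ σ) (^-intertwine x) ⟩
    x · σ · y ^ σ         ≡⟨ ·-assoc x σ (y ^ σ) ⟩
    x · (σ · y ^ σ)       ≡⟨ cong (x ·_) (^-intertwine y) ⟩
    x · (y · σ)           ≡⟨ sym (·-assoc x y σ) ⟩
    x · y · σ             ≡⟨ sym (^-intertwine (x · y)) ⟩
    σ · (x · y) ^ σ       ∎))

  idP-^ : idP ^ σ ≡ idP
  idP-^ = ·-cancelˡ (trans (^-intertwine idP) (trans (·-identityˡ σ) (sym (·-identityʳ σ))))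

  ^-inverseʳ : ∀ x → σ · x ^ σ · inv σ ≡ x
  ^-inverseʳ x = begin
    σ · x ^ σ · inv σ     ≡⟨ cong (_· inv σ) (^-intertwine x) ⟩
    x · σ · inv σ         ≡⟨ ·-assoc x σ (inv σ) ⟩
    x · (σ · inv σ)       ≡⟨ cong (x ·_) (·-inverseʳ σ∈) ⟩
    x · idP               ≡⟨ ·-identityʳ x ⟩
    x                     ∎

  ^-inverseˡ : ∀ x → (σ · x · inv σ) ^ σ ≡ x
  ^-inverseˡ x = ·-cancelˡ (begin
    σ · (σ · x · inv σ) ^ σ   ≡⟨ ^-intertwine (σ · x · inv σ) ⟩
    σ · x · inv σ · σ         ≡⟨ ·-assoc (σ · x) (inv σ) σ ⟩
    σ · x · (inv σ · σ)       ≡⟨ cong (σ · x ·_) (·-inverseˡ σ∈) ⟩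
    σ · x · idP               ≡⟨ ·-identityʳ (σ · x) ⟩
    σ · x                     ∎)

  ^-injective : ∀ {x y} → x ^ σ ≡ y ^ σ → x ≡ y
  ^-injective {x} {y} eq = begin
    x                     ≡⟨ sym (^-inverseʳ x) ⟩
    σ · x ^ σ · inv σ     ≡⟨ cong (λ z → σ · z · inv σ) eq ⟩
    σ · y ^ σ · inv σ     ≡⟨ ^-inverseʳ y ⟩
    y                     ∎

  pow-·-fold-^ : ∀ x m → pow σ m · fold x (_^ σ) m ≡ x · pow σ m
  pow-·-fold-^ x zero    = trans (·-identityˡ x) (sym (·-identityʳ x))
  pow-·-fold-^ x (suc m) = begin
    pow σ (suc m) · y ^ σ     ≡⟨ cong (_· y ^ σ) (pow-suc σ m) ⟩
    pow σ m · σ · y ^ σ       ≡⟨ ·-assoc (pow σ m) σ (y ^ σ) ⟩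
    pow σ m · (σ · y ^ σ)     ≡⟨ cong (pow σ m ·_) (^-intertwine y) ⟩
    pow σ m · (y · σ)         ≡⟨ sym (·-assoc (pow σ m) y σ) ⟩
    pow σ m · y · σ           ≡⟨ cong (_· σ) (pow-·-fold-^ x m) ⟩
    x · pow σ m · σ           ≡⟨ ·-assoc x (pow σ m) σ ⟩
    x · (pow σ m · σ)         ≡⟨ cong (x ·_) (sym (pow-suc σ m)) ⟩
    x · pow σ (suc m)         ∎
    where y = fold x (_^ σ) m

  fold-^-order : ∀ x {m} → pow σ m ≡ idP → fold x (_^ σ) m ≡ x
  fold-^-order x {m} σᵐ≡idP = begin
    fold x (_^ σ) m             ≡⟨ sym (·-identityˡ _) ⟩
    idP · fold x (_^ σ) m       ≡⟨ cong (_· fold x (_^ σ) m) (sym σᵐ≡idP) ⟩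
    pow σ m · fold x (_^ σ) m   ≡⟨ pow-·-fold-^ x m ⟩
    x · pow σ m                 ≡⟨ cong (x ·_) σᵐ≡idP ⟩
    x · idP                     ≡⟨ ·-identityʳ x ⟩
    x                           ∎

-- Generation of A₅ by a and b

-- a = (12)(34) and b = (135), so that a² = b³ = (ab)⁵ = 1
a b : Perm5
a = # 1 ∷ # 0 ∷ # 3 ∷ # 2 ∷ # 4 ∷ []
b = # 2 ∷ # 1 ∷ # 4 ∷ # 3 ∷ # 0 ∷ []

a≢idP : a ≢ idP
a≢idP ()

ball-step : List Perm5 → List Perm5
ball-step xs = xs ++ deduplicate _≟P_ (filter (λ x → ¬? (x ∈? xs)) (mapL (a ·_) xs ++ mapL (b ·_) xs))

ball : ℕ → List Perm5
ball zero    = [ idP ]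
ball (suc n) = ball-step (ball n)

∈-ball-step⁻ : ∀ xs {x} → x ∈ ball-step xs → x ∈ xs ⊎ ∃ λ y → y ∈ xs × (x ≡ a · y ⊎ x ≡ b · y)
∈-ball-step⁻ xs x∈ with ∈-++⁻ xs x∈
... | inj₁ x∈xs = inj₁ x∈xs
... | inj₂ x∈new with ∈-++⁻ (mapL (a ·_) xs) (proj₁ (∈-filter⁻ (λ x → ¬? (x ∈? xs)) (∈-deduplicate⁻ _≟P_ _ x∈new)))
...   | inj₁ x∈aXs = let y , y∈ , x≡ay = ∈-map⁻ (a ·_) x∈aXs in inj₂ (y , y∈ , inj₁ x≡ay)
...   | inj₂ x∈bXs = let y , y∈ , x≡by = ∈-map⁻ (b ·_) x∈bXs in inj₂ (y , y∈ , inj₂ x≡by)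

opaque
  unfolding A5

  A5⊆ball₁₂ : All (_∈ ball 12) A5
  A5⊆ball₁₂ = from-yes (all? (_∈? ball 12) A5)

  A5-centre-trivial : All (λ x → x · a ≡ a · x → x · b ≡ b · x → x ≡ idP) A5
  A5-centre-trivial = from-yes (all? (λ x → ((x · a) ≟P (a · x)) →-dec ((x · b) ≟P (b · x)) →-dec (x ≟P idP)) A5)

module _ (P : Perm5 → Set) (P-idP : P idP)
         (P-a : ∀ x → InA5 x → P x → P (a · x)) (P-b : ∀ x → InA5 x → P x → P (b · x)) where

  ball-induction : ∀ n {x} → x ∈ ball n → InA5 x × P x
  ball-induction zero (here refl) = _ , P-idP
  ball-induction (suc n) x∈ with ∈-ball-step⁻ (ball n) x∈
  ... | inj₁ x∈ₙ = ball-induction n x∈ₙ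
  ... | inj₂ (y , y∈ , inj₁ refl) = let y∈A5 , Py = ball-induction n y∈ in InA5-· a y _ y∈A5 , P-a y y∈A5 Py
  ... | inj₂ (y , y∈ , inj₂ refl) = let y∈A5 , Py = ball-induction n y∈ in InA5-· b y _ y∈A5 , P-b y y∈A5 Py

  ab-induction : ∀ x → InA5 x → P x
  ab-induction x x∈ = proj₂ (ball-induction 12 (All.lookup A5⊆ball₁₂ (∈A5⁺ x x∈)))

-- Automorphisms of A₅

A5Relations : Perm5 × Perm5 → Set
A5Relations (x , y) = x ≢ idP × pow x 2 ≡ idP × pow y 3 ≡ idP × pow (x · y) 5 ≡ idP

a5Relations? : Decidable A5Relations
a5Relations? (x , y) =
  ¬? (x ≟P idP) ×-dec (pow x 2 ≟P idP) ×-dec (pow y 3 ≟P idP) ×-dec (pow (x · y) 5 ≟P idP)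

opaque
  unfolding A5

  A5Relations-conjugate : All (λ p → Any (λ σ → (a ^ σ , b ^ σ) ≡ p) S5) (filter a5Relations? (cartesianProduct A5 A5))
  A5Relations-conjugate = from-yes
    (all-any? (λ p σ → Product.≡-dec _≟P_ _≟P_ (a ^ σ , b ^ σ) p) (filter a5Relations? (cartesianProduct A5 A5)) S5)

record IsMonomorphism (ρ : Perm5 → Perm5) : Set where
  field
    preserves-A5   : ∀ x → InA5 x → InA5 (ρ x)
    homomorphic    : ∀ x y → InA5 x → InA5 y → ρ (x · y) ≡ ρ x · ρ y
    trivial-kernel : ∀ x → InA5 x → ρ x ≡ idP → x ≡ idP

module _ {ρ : Perm5 → Perm5} (mono : IsMonomorphism ρ) where
  open IsMonomorphism mono

  ρ-idP : ρ idP ≡ idP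
  ρ-idP = sym (·-cancelˡ (InA5⇒∈S5 (ρ idP) (preserves-A5 idP _)) (trans (·-identityʳ (ρ idP)) (homomorphic idP idP _ _)))

  ρ-pow : ∀ x n → InA5 x → ρ (pow x n) ≡ pow (ρ x) n
  ρ-pow x zero    _  = ρ-idP
  ρ-pow x (suc n) x∈ = trans (homomorphic x (pow x n) x∈ (InA5-pow x n x∈)) (cong (ρ x ·_) (ρ-pow x n x∈))

  ρ-A5Relations : A5Relations (ρ a , ρ b)
  ρ-A5Relations =
    (λ ρa≡idP → a≢idP (trivial-kernel a _ ρa≡idP)) ,
    trans (sym (ρ-pow a 2 _)) ρ-idP ,
    trans (sym (ρ-pow b 3 _)) ρ-idP ,
    (begin
      pow (ρ a · ρ b) 5   ≡⟨ cong (λ z → pow z 5) (sym (homomorphic a b _ _)) ⟩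
      pow (ρ (a · b)) 5   ≡⟨ sym (ρ-pow (a · b) 5 _) ⟩
      ρ (pow (a · b) 5)   ≡⟨ ρ-idP ⟩
      idP                 ∎)

  monomorphism-is-conjugation : ∃ λ σ → σ ∈ S5 × (∀ x → InA5 x → ρ x ≡ x ^ σ)
  monomorphism-is-conjugation =
    σ , σ∈ , ab-induction (λ x → ρ x ≡ x ^ σ) (trans ρ-idP (sym (idP-^ σ∈)))
               (extend a _ (cong proj₁ (sym ab^σ))) (extend b _ (cong proj₂ (sym ab^σ)))
    where
    ρab∈ = ∈-cartesianProduct⁺ {xs = A5} {ys = A5} (∈A5⁺ (ρ a) (preserves-A5 a _)) (∈A5⁺ (ρ b) (preserves-A5 b _))
    conjugator = find (All.lookup A5Relations-conjugate
                   (∈-filter⁺ a5Relations? {xs = cartesianProduct A5 A5} ρab∈ ρ-A5Relations))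
    σ = proj₁ conjugator
    σ∈ = proj₁ (proj₂ conjugator)
    ab^σ : (a ^ σ , b ^ σ) ≡ (ρ a , ρ b)
    ab^σ = proj₂ (proj₂ conjugator)

    extend : ∀ g → InA5 g → ρ g ≡ g ^ σ → ∀ x → InA5 x → ρ x ≡ x ^ σ → ρ (g · x) ≡ (g · x) ^ σ
    extend g g∈ ρg x x∈ ρx = begin
      ρ (g · x)       ≡⟨ homomorphic g x g∈ x∈ ⟩
      ρ g · ρ x       ≡⟨ cong₂ _·_ ρg ρx ⟩
      g ^ σ · x ^ σ   ≡⟨ sym (^-distrib-· σ∈ g x) ⟩
      (g · x) ^ σ     ∎

fold-commute : ∀ {A B : Set} (s : A → A) (t : B → B) (h : A → B) →
               (∀ x → h (s x) ≡ t (h x)) → ∀ x m → h (fold x s m) ≡ fold (h x) t m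
fold-commute s t h comm x zero    = refl
fold-commute s t h comm x (suc m) = trans (comm (fold x s m)) (cong t (fold-commute s t h comm x m))

fold-next-next : ∀ {k} (i : Fin k) m → fold (next i) next m ≡ next (fold i next m)
fold-next-next i m = sym (fold-commute next next next (λ _ → refl) i m)

suc-% : ∀ x n .{{_ : NonZero n}} → suc (x % n) % n ≡ suc x % n
suc-% x n = begin
  suc (x % n) % n               ≡⟨ %-distribˡ-+ 1 (x % n) n ⟩
  (1 % n + x % n % n) % n       ≡⟨ cong (λ z → (1 % n + z) % n) (m%n%n≡m%n x n) ⟩
  (1 % n + x % n) % n           ≡⟨ sym (%-distribˡ-+ 1 x n) ⟩
  suc x % n                     ∎

toℕ-fold-next : ∀ {k} (i : Fin (suc k)) m → toℕ (fold i next m) ≡ (toℕ i + m) % suc k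
toℕ-fold-next {k} i zero    = sym (trans (cong (_% suc k) (+-identityʳ (toℕ i))) (m<n⇒m%n≡m (toℕ<n i)))
toℕ-fold-next {k} i (suc m) = begin
  toℕ (next (fold i next m))          ≡⟨ toℕ-fromℕ< _ ⟩
  suc (toℕ (fold i next m)) % suc k   ≡⟨ cong (λ z → suc z % suc k) (toℕ-fold-next i m) ⟩
  suc ((toℕ i + m) % suc k) % suc k   ≡⟨ suc-% (toℕ i + m) (suc k) ⟩
  suc (toℕ i + m) % suc k             ≡⟨ cong (_% suc k) (sym (+-suc (toℕ i) m)) ⟩
  (toℕ i + suc m) % suc k             ∎

fold-next-≡ : ∀ {k} {i j : Fin (suc k)} m → (toℕ i + m) % suc k ≡ toℕ j → fold i next m ≡ j
fold-next-≡ {i = i} m eq = toℕ-injective (trans (toℕ-fold-next i m) eq)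

fold-next-toℕ : ∀ {k} (i : Fin (suc k)) → fold zero next (toℕ i) ≡ i
fold-next-toℕ i = fold-next-≡ (toℕ i) (m<n⇒m%n≡m (toℕ<n i))

toℕ-fold-next-zero : ∀ {k} m → m < suc k → toℕ (fold {A = Fin (suc k)} zero next m) ≡ m
toℕ-fold-next-zero m m<k = trans (toℕ-fold-next zero m) (m<n⇒m%n≡m m<k)

fold-next-periodic : ∀ {k} (i : Fin (suc k)) n → fold i next (n * suc k) ≡ i
fold-next-periodic {k} i n =
  fold-next-≡ (n * suc k) (trans ([m+kn]%n≡m%n (toℕ i) n (suc k)) (m<n⇒m%n≡m (toℕ<n i)))

fold-next-period : ∀ {k} (i : Fin (suc k)) → fold i next (suc k) ≡ i
fold-next-period {k} i = trans (cong (fold i next) (sym (*-identityˡ (suc k)))) (fold-next-periodic i 1)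

fold-next-reach : ∀ {k} (j i : Fin (suc k)) → fold j next (toℕ j * k + toℕ i) ≡ i
fold-next-reach {k} j i = fold-next-≡ (toℕ j * k + toℕ i) (begin
  (toℕ j + (toℕ j * k + toℕ i)) % suc k   ≡⟨ cong (_% suc k) (sym (+-assoc (toℕ j) (toℕ j * k) (toℕ i))) ⟩
  (toℕ j + toℕ j * k + toℕ i) % suc k     ≡⟨ cong (λ z → (z + toℕ i) % suc k) (sym (*-suc (toℕ j) k)) ⟩
  (toℕ j * suc k + toℕ i) % suc k         ≡⟨ cong (_% suc k) (+-comm (toℕ j * suc k) (toℕ i)) ⟩
  (toℕ i + toℕ j * suc k) % suc k         ≡⟨ [m+kn]%n≡m%n (toℕ i) (toℕ j) (suc k) ⟩
  toℕ i % suc k                           ≡⟨ m<n⇒m%n≡m (toℕ<n i) ⟩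
  toℕ i                                   ∎)

fold-next-surjective : ∀ {k} c (j : Fin (suc k)) → fold (fold j next (c * k)) next c ≡ j
fold-next-surjective {k} c j = begin
  fold (fold j next (c * k)) next c   ≡⟨ sym (fold-+ j next c) ⟩
  fold j next (c + c * k)             ≡⟨ cong (fold j next) (sym (*-suc c k)) ⟩
  fold j next (c * suc k)             ≡⟨ fold-next-periodic j c ⟩
  j                                   ∎

commutes-with-next⇒≗next : ∀ {k} (h : Fin (suc k) → Fin (suc k)) → (∀ i → h (next i) ≡ next (h i)) →
                           ∀ j → h j ≡ next j → h ≗ next
commutes-with-next⇒≗next {k} h comm j hj i = subst (λ z → h z ≡ next z) (fold-next-reach j i) (begin
  h (fold j next m)      ≡⟨ fold-commute next next h comm j m ⟩
  fold (h j) next m      ≡⟨ cong (λ z → fold z next m) hj ⟩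
  fold (next j) next m   ≡⟨ fold-next-next j m ⟩
  next (fold j next m)   ∎)
  where m = toℕ j * k + toℕ i

conjugation-iso : ∀ {k} {Ω Ω' : Vec Perm5 (suc k)} {τ} c → InA5 τ →
                  (∀ i → lookup Ω i ^ τ ≡ lookup Ω' (fold i next c)) → Iso Ω Ω'
conjugation-iso {k} {Ω} {Ω'} {τ} c τ∈ transport = record
  { f        = _^ τ
  ; g        = λ η → τ · η · inv τ
  ; φ        = λ _ i → fold i next c
  ; f-A5     = λ η η∈ → InA5-· (inv τ · η) τ (InA5-· (inv τ) η (InA5-inv τ τ∈) η∈) τ∈
  ; g-A5     = λ η η∈ → InA5-· (τ · η) (inv τ) (InA5-· τ η τ∈ η∈) (InA5-inv τ τ∈)
  ; gf       = λ η _ → ^-inverseʳ τ∈S5 η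
  ; fg       = λ η _ → ^-inverseˡ τ∈S5 η
  ; arc      = λ η _ → arc-^τ η
  ; refl-adj = λ η η′ _ _ j η′^τ≡ → let i = fold j next (c * k) in
      i , ^-injective τ∈S5 (begin
        η′ ^ τ                              ≡⟨ η′^τ≡ ⟩
        η ^ τ · lookup Ω' j                 ≡⟨ cong (λ z → η ^ τ · lookup Ω' z) (sym (fold-next-surjective c j)) ⟩
        η ^ τ · lookup Ω' (fold i next c)   ≡⟨ sym (arc-^τ η i) ⟩
        (η · lookup Ω i) ^ τ                ∎)
  ; rot      = λ _ _ i → fold-next-next i c
  }
  where
  τ∈S5 = InA5⇒∈S5 τ τ∈

  arc-^τ : ∀ η i → (η · lookup Ω i) ^ τ ≡ η ^ τ · lookup Ω' (fold i next c)
  arc-^τ η i = trans (^-distrib-· τ∈S5 η (lookup Ω i)) (cong (η ^ τ ·_) (transport i))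

module CayleyMapProperties {k} {Ω : Vec Perm5 k} (cayley : IsCayleyMap Ω) where
  open IsCayleyMap cayley

  Ω-induction : (P : Perm5 → Set) → P idP → (∀ η → InA5 η → P η → ∀ i → P (η · lookup Ω i)) →
                ∀ η → InA5 η → P η
  Ω-induction P P-idP P-step η η∈ =
    subst P (trans (·-identityˡ _) (proj₂ (generates η η∈))) (along (proj₁ (generates η η∈)) idP _ P-idP)
    where
    along : ∀ w η → InA5 η → P η → P (η · prod (mapL (lookup Ω) w))
    along []      η η∈ Pη = subst P (sym (·-identityʳ η)) Pη
    along (i ∷ w) η η∈ Pη = subst P (·-assoc η (lookup Ω i) (prod (mapL (lookup Ω) w)))
      (along w (η · lookup Ω i) (InA5-· η (lookup Ω i) η∈ (inA5 i)) (P-step η η∈ Pη i))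

  commutes-with-generators⇒central : ∀ x → (∀ j → x · lookup Ω j ≡ lookup Ω j · x) →
                                     ∀ η → InA5 η → x · η ≡ η · x
  commutes-with-generators⇒central x central =
    Ω-induction (λ η → x · η ≡ η · x) (trans (·-identityʳ x) (sym (·-identityˡ x))) step
    where
    step : ∀ η → InA5 η → x · η ≡ η · x → ∀ j → x · (η · lookup Ω j) ≡ η · lookup Ω j · x
    step η _ xη≡ηx j = let ωj = lookup Ω j in begin
      x · (η · ωj)   ≡⟨ sym (·-assoc x η ωj) ⟩
      x · η · ωj     ≡⟨ cong (_· ωj) xη≡ηx ⟩
      η · x · ωj     ≡⟨ ·-assoc η x ωj ⟩
      η · (x · ωj)   ≡⟨ cong (η ·_) (central j) ⟩
      η · (ωj · x)   ≡⟨ sym (·-assoc η ωj x) ⟩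
      η · ωj · x     ∎

  generator-not-central : ∀ i → ¬ (∀ j → lookup Ω i · lookup Ω j ≡ lookup Ω j · lookup Ω i)
  generator-not-central i central =
    noId i (All.lookup A5-centre-trivial (∈A5⁺ x (inA5 i)) (commutes a _) (commutes b _))
    where
    x = lookup Ω i
    commutes = commutes-with-generators⇒central x central

-- Classification of the admissible orbits

orbitOf : Perm5 → Perm5 → ∀ {k} → Fin k → Perm5
orbitOf σ ω i = fold ω (_^ σ) (toℕ i)

Admissible : ∀ k → Perm5 × Perm5 → Set
Admissible k (σ , ω) =
  ω · ω ≢ idP × fold ω (_^ σ) k ≡ ω × (∃ λ (j : Fin k) → orbitOf σ ω j ≡ inv ω) ×
  ¬ (∀ (j : Fin k) → ω · orbitOf σ ω j ≡ orbitOf σ ω j · ω)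

admissible? : ∀ k → Decidable (Admissible k)
admissible? k (σ , ω) =
  ¬? ((ω · ω) ≟P idP) ×-dec (fold ω (_^ σ) k ≟P ω) ×-dec anyFin? (λ j → orbitOf σ ω j ≟P inv ω) ×-dec
  ¬? (allFin? λ j → (ω · orbitOf σ ω j) ≟P (orbitOf σ ω j · ω))

Transports : ∀ {k} → Vec Perm5 k → Perm5 × Perm5 → Perm5 × ℕ → Set
Transports {k} Ω' (σ , ω) (τ , c) = ∀ (i : Fin k) → orbitOf σ ω i ^ τ ≡ lookup Ω' (fold i next c)

transports? : ∀ {k} (Ω' : Vec Perm5 k) p q → Dec (Transports Ω' p q)
transports? Ω' (σ , ω) (τ , c) = allFin? λ i → (orbitOf σ ω i ^ τ) ≟P lookup Ω' (fold i next c)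

Classification : ∀ {k} → Vec Perm5 k → Set
Classification {k} Ω' =
  All (λ p → Any (Transports Ω' p) (cartesianProduct A5 (upTo k))) (filter (admissible? k) (cartesianProduct S5 A5))

classification? : ∀ {k} (Ω' : Vec Perm5 k) → Dec (Classification Ω')
classification? {k} Ω' =
  all-any? (transports? Ω') (filter (admissible? k) (cartesianProduct S5 A5)) (cartesianProduct A5 (upTo k))

-- The explicit valencies make these types syntactically equal to the ones `classify` expects below;
-- otherwise checking them against each other would evaluate and compare the filtered lists.
opaque
  unfolding A5

  classification₄ : Classification {4} (CMgens c1425 c123)
  classification₄ = from-yes (classification? {4} (CMgens c1425 c123))

  classification₆ : Classification {6} (CMgens c12-345 c123)
  classification₆ = from-yes (classification? {6} (CMgens c12-345 c123))

-- Regular balanced Cayley maps on A₅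

module RBCMProperties {k} {Ω : Vec Perm5 (suc k)} (R : RBCM Ω) where
  open RBCM R
  open IsCayleyMap cayley
  open CayleyMapProperties cayley

  private
    ω : Fin (suc k) → Perm5
    ω = lookup Ω

  rotation-automorphism : Σ[ F ∈ Iso Ω Ω ] f F idP ≡ idP × (∀ η → InA5 η → φ F η ≗ next)
  rotation-automorphism = F , f-idP , Ω-induction (λ η → φ F η ≗ next) φ-idP φ-step
    where
    arc-transitivity = regular idP idP _ _ zero (next zero)
    F = proj₁ arc-transitivity
    f-idP = proj₁ (proj₂ arc-transitivity)

    φ-idP : φ F idP ≗ next
    φ-idP = commutes-with-next⇒≗next (φ F idP) (rot F idP _) zero (proj₂ (proj₂ arc-transitivity))

    -- The arc (η ωᵢ, ωⱼ) with ωⱼ = ωᵢ⁻¹ leads back to η, so F sends it to an arc labelled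
    -- ωᵢ₊₁⁻¹, which is ωⱼ₊₁ by balancedness.
    φ-step : ∀ η → InA5 η → φ F η ≗ next → ∀ i → φ F (η · ω i) ≗ next
    φ-step η η∈ φη≗next i = commutes-with-next⇒≗next (φ F η′) (rot F η′ η′∈) j (distinct _ _ ω-φη′j)
      where
      η′ = η · ω i
      η′∈ = InA5-· η (ω i) η∈ (inA5 i)
      j = proj₁ (invClosed i)
      ωj≡ωi⁻¹ = proj₂ (invClosed i)

      back : η′ · ω j ≡ η
      back = begin
        η · ω i · ω j           ≡⟨ ·-assoc η (ω i) (ω j) ⟩
        η · (ω i · ω j)         ≡⟨ cong (λ z → η · (ω i · z)) ωj≡ωi⁻¹ ⟩
        η · (ω i · inv (ω i))   ≡⟨ cong (η ·_) (·-inverseʳ (InA5⇒∈S5 (ω i) (inA5 i))) ⟩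
        η · idP                 ≡⟨ ·-identityʳ η ⟩
        η                       ∎

      f-back : f F η · (ω (next i) · ω (φ F η′ j)) ≡ f F η · idP
      f-back = begin
        f F η · (ω (next i) · ω (φ F η′ j))   ≡⟨ sym (·-assoc (f F η) (ω (next i)) (ω (φ F η′ j))) ⟩
        f F η · ω (next i) · ω (φ F η′ j)     ≡⟨ cong (λ z → f F η · ω z · ω (φ F η′ j)) (sym (φη≗next i)) ⟩
        f F η · ω (φ F η i) · ω (φ F η′ j)    ≡⟨ cong (_· ω (φ F η′ j)) (sym (arc F η η∈ i)) ⟩
        f F η′ · ω (φ F η′ j)                 ≡⟨ sym (arc F η′ η′∈ j) ⟩
        f F (η′ · ω j)                        ≡⟨ cong (f F) back ⟩
        f F η                                 ≡⟨ sym (·-identityʳ (f F η)) ⟩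
        f F η · idP                           ∎

      ω-φη′j : ω (φ F η′ j) ≡ ω (next j)
      ω-φη′j = trans (inverse-unique (InA5⇒∈S5 (ω (next i)) (inA5 (next i)))
                                     (·-cancelˡ (InA5⇒∈S5 (f F η) (f-A5 F η η∈)) f-back))
                     (sym (balanced i j ωj≡ωi⁻¹))

  rotation-monomorphism : Σ[ ρ ∈ (Perm5 → Perm5) ] IsMonomorphism ρ × (∀ i → ρ (ω i) ≡ ω (next i))
  rotation-monomorphism =
    ρ , record { preserves-A5 = f-A5 F ; homomorphic = homomorphic ; trivial-kernel = trivial-kernel } , ρ-ω
    where
    F = proj₁ rotation-automorphism
    ρ = f F
    ρ-fixes-idP = proj₁ (proj₂ rotation-automorphism)

    ρ-arc : ∀ η → InA5 η → ∀ i → ρ (η · ω i) ≡ ρ η · ω (next i)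
    ρ-arc η η∈ i = trans (arc F η η∈ i) (cong (λ z → ρ η · ω z) (proj₂ (proj₂ rotation-automorphism) η η∈ i))

    ρ-ω : ∀ i → ρ (ω i) ≡ ω (next i)
    ρ-ω i = begin
      ρ (ω i)              ≡⟨ cong ρ (sym (·-identityˡ (ω i))) ⟩
      ρ (idP · ω i)        ≡⟨ ρ-arc idP _ i ⟩
      ρ idP · ω (next i)   ≡⟨ cong (_· ω (next i)) ρ-fixes-idP ⟩
      idP · ω (next i)     ≡⟨ ·-identityˡ (ω (next i)) ⟩
      ω (next i)           ∎

    homomorphic : ∀ x y → InA5 x → InA5 y → ρ (x · y) ≡ ρ x · ρ y
    homomorphic x y x∈ y∈ = Ω-induction (λ y → ∀ x → InA5 x → ρ (x · y) ≡ ρ x · ρ y) base step y y∈ x x∈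
      where
      base : ∀ x → InA5 x → ρ (x · idP) ≡ ρ x · ρ idP
      base x _ = trans (cong ρ (·-identityʳ x)) (sym (trans (cong (ρ x ·_) ρ-fixes-idP) (·-identityʳ (ρ x))))

      step : ∀ y → InA5 y → (∀ x → InA5 x → ρ (x · y) ≡ ρ x · ρ y) →
             ∀ i x → InA5 x → ρ (x · (y · ω i)) ≡ ρ x · ρ (y · ω i)
      step y y∈ hom i x x∈ = begin
        ρ (x · (y · ω i))          ≡⟨ cong ρ (sym (·-assoc x y (ω i))) ⟩
        ρ (x · y · ω i)            ≡⟨ ρ-arc (x · y) (InA5-· x y x∈ y∈) i ⟩
        ρ (x · y) · ω (next i)     ≡⟨ cong (_· ω (next i)) (hom x x∈) ⟩
        ρ x · ρ y · ω (next i)     ≡⟨ ·-assoc (ρ x) (ρ y) (ω (next i)) ⟩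
        ρ x · (ρ y · ω (next i))   ≡⟨ cong (ρ x ·_) (sym (ρ-arc y y∈ i)) ⟩
        ρ x · ρ (y · ω i)          ∎

    trivial-kernel : ∀ x → InA5 x → ρ x ≡ idP → x ≡ idP
    trivial-kernel x x∈ ρx≡idP = begin
      x             ≡⟨ sym (gf F x x∈) ⟩
      g F (ρ x)     ≡⟨ cong (g F) (trans ρx≡idP (sym ρ-fixes-idP)) ⟩
      g F (ρ idP)   ≡⟨ gf F idP _ ⟩
      idP           ∎

  generators-form-conjugation-orbit : ∃ λ σ → σ ∈ S5 × (∀ i → ω (next i) ≡ ω i ^ σ)
  generators-form-conjugation-orbit =
    let ρ , mono , ρ-ω = rotation-monomorphism
        σ , σ∈ , ρ≡^σ = monomorphism-is-conjugation mono
    in σ , σ∈ , λ i → trans (sym (ρ-ω i)) (ρ≡^σ (ω i) (inA5 i))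

  private
    σ = proj₁ generators-form-conjugation-orbit
    σ∈ = proj₁ (proj₂ generators-form-conjugation-orbit)

    ω-fold : ∀ m → ω (fold zero next m) ≡ fold (ω zero) (_^ σ) m
    ω-fold = fold-commute next (_^ σ) ω (proj₂ (proj₂ generators-form-conjugation-orbit)) zero

    ω-orbit : ∀ i → orbitOf σ (ω zero) i ≡ ω i
    ω-orbit i = trans (sym (ω-fold (toℕ i))) (cong ω (fold-next-toℕ i))

  valency≤6 : ¬ (6 < suc k)
  valency≤6 6<valency =
    1+n≢0 (trans (sym (toℕ-fold-next-zero (suc m) (<-≤-trans (s≤s m<6) 6<valency))) (cong toℕ returns-to-zero))
    where
    order = find (All.lookup S5-order≤6 σ∈)
    m = proj₁ order
    m<6 = ∈-upTo⁻ (proj₁ (proj₂ order))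

    returns-to-zero : fold zero next (suc m) ≡ zero
    returns-to-zero = distinct _ _ (trans (ω-fold (suc m)) (fold-^-order σ∈ (ω zero) {suc m} (proj₂ (proj₂ order))))

  classify : ∀ {Ω' : Vec Perm5 (suc k)} → Classification Ω' → TypeI Ω → Iso Ω Ω'
  classify {Ω'} certificate typeI =
    conjugation-iso {τ = τ} c (∈A5⁻ (proj₁ (∈-cartesianProduct⁻ A5 (upTo (suc k)) τc∈)))
      (λ i → trans (cong (_^ τ) (sym (ω-orbit i))) (transports i))
    where
    admissible : Admissible (suc k) (σ , ω zero)
    admissible = typeI zero
               , trans (sym (ω-fold (suc k))) (cong ω (fold-next-period zero))
               , (proj₁ (invClosed zero) , trans (ω-orbit _) (proj₂ (invClosed zero)))
               , λ central → generator-not-central zero λ j → subst (λ z → ω zero · z ≡ z · ω zero) (ω-orbit j) (central j)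

    σω∈ = ∈-filter⁺ (admissible? (suc k)) {xs = cartesianProduct S5 A5}
            (∈-cartesianProduct⁺ {xs = S5} {ys = A5} σ∈ (∈A5⁺ (ω zero) (inA5 zero))) admissible
    found = find (All.lookup certificate σω∈)
    τ = proj₁ (proj₁ found)
    c = proj₂ (proj₁ found)
    τc∈ = proj₁ (proj₂ found)
    transports = proj₂ (proj₂ found)

valency≤6 : ∀ {k} {Ω : Vec Perm5 k} → RBCM Ω → ¬ (6 < k)
valency≤6 {zero}  _ ()
valency≤6 {suc k} R = RBCMProperties.valency≤6 R

theorem3p1 : (∀ (Ω : Vec Perm5 4) → RBCM Ω → TypeI Ω → Iso Ω (CMgens c1425 c123))
    × (∀ (Ω : Vec Perm5 6) → RBCM Ω → TypeI Ω → Iso Ω (CMgens c12-345 c123))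
    × (∀ (n : ℕ) → 3 < n → (Ω : Vec Perm5 (2 * n)) → RBCM Ω → TypeI Ω → ⊥)
theorem3p1 =
  (λ Ω R → RBCMProperties.classify R classification₄) ,
  (λ Ω R → RBCMProperties.classify R classification₆) ,
  (λ n 3<n Ω R _ → valency≤6 R (≤-trans (n≤1+n 7) (*-monoʳ-≤ 2 3<n)))
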